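{- Let $L$ be any consistent normal extension of $\mathbf{CL}$ and $\varphi$ any $\mathcal{L}(\Box,\rhd)$-formula. If $\varphi\in L$, then $\Box\bot\to\varphi\in\mathbf{CL}$.
   Context: $\mathcal{L}(\Box,\rhd)$ has countably many propositional variables, $\top,\bot$, $\neg,\land,\lor,\to$, unary $\Box,\Diamond$ ($\Diamond$ dual of $\Box$) and binary $\rhd$. $\mathbf{CL}$ is the smallest set of formulas containing all propositional tautologies, $\Box(p\to q)\to(\Box p\to\Box q)$, $\Box(\Box p\to p)\to\Box p$, J1: $\Box(p\to q)\to(p\rhd q)$; J2: $(p\rhd q)\land(q\rhd r)\to(p\rhd r)$; J3: $(p\rhd r)\land(q\rhd r)\to((p\lor q)\rhd r)$; J4: $(p\rhd q)\to(\Diamond p\to\Diamond q)$, closed under modus ponens, necessitation ($\varphi/\Box\varphi$) and uniform substitution. A normal extension of $\mathbf{CL}$ is a set $L\supseteq\mathbf{CL}$ closed under these three rules; it is consistent if $\bot\notin L$. -}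

module Defs where

open import Data.Nat using (ℕ)
open import Data.Bool using (Bool; true; false; not; _∧_; _∨_)
open import Relation.Binary.PropositionalEquality using (_≡_)
open import Relation.Nullary using (¬_)

infixr 5 _⇒_
infixl 7 _∧'_
infixl 6 _∨'_
infix 8 _▷_
data Formula : Set where
  var   : ℕ → Formula
  ⊤'    : Formula
  ⊥'    : Formula
  ¬'_   : Formula → Formula
  _∧'_  : Formula → Formula → Formula
  _∨'_  : Formula → Formula → Formula
  _⇒_   : Formula → Formula → Formula
  □_    : Formula → Formula
  _▷_   : Formula → Formula → Formula

◇_ : Formula → Formula
◇ φ = ¬' (□ (¬' φ))

_⇒ᵇ_ : Bool → Bool → Bool
a ⇒ᵇ b = not a ∨ b

eval : (Formula → Bool) → Formula → Bool
eval v (var n)   = v (var n)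
eval v ⊤'        = true
eval v ⊥'        = false
eval v (¬' φ)    = not (eval v φ)
eval v (φ ∧' ψ)  = eval v φ ∧ eval v ψ
eval v (φ ∨' ψ)  = eval v φ ∨ eval v ψ
eval v (φ ⇒ ψ)   = eval v φ ⇒ᵇ eval v ψ
eval v (□ φ)     = v (□ φ)
eval v (φ ▷ ψ)   = v (φ ▷ ψ)

-- propositional tautology (instance of a classical tautology)
Tautology : Formula → Set
Tautology φ = ∀ (v : Formula → Bool) → eval v φ ≡ true

Subst : Set
Subst = ℕ → Formula

sub : Subst → Formula → Formula
sub σ (var n)   = σ n
sub σ ⊤'        = ⊤'
sub σ ⊥'        = ⊥'
sub σ (¬' φ)    = ¬' sub σ φ
sub σ (φ ∧' ψ)  = sub σ φ ∧' sub σ ψ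
sub σ (φ ∨' ψ)  = sub σ φ ∨' sub σ ψ
sub σ (φ ⇒ ψ)   = sub σ φ ⇒ sub σ ψ
sub σ (□ φ)     = □ sub σ φ
sub σ (φ ▷ ψ)   = sub σ φ ▷ sub σ ψ

p q r : Formula
p = var 0
q = var 1
r = var 2

data CL : Formula → Set where
  taut : ∀ {φ} → Tautology φ → CL φ
  axK  : CL (□ (p ⇒ q) ⇒ (□ p ⇒ □ q))
  axL  : CL (□ (□ p ⇒ p) ⇒ □ p)
  axJ1 : CL (□ (p ⇒ q) ⇒ (p ▷ q))
  axJ2 : CL ((p ▷ q) ∧' (q ▷ r) ⇒ (p ▷ r))
  axJ3 : CL ((p ▷ r) ∧' (q ▷ r) ⇒ ((p ∨' q) ▷ r))
  axJ4 : CL ((p ▷ q) ⇒ (◇ p ⇒ ◇ q))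
  mp   : ∀ {φ ψ} → CL (φ ⇒ ψ) → CL φ → CL ψ
  nec  : ∀ {φ} → CL φ → CL (□ φ)
  us   : ∀ {φ} (σ : Subst) → CL φ → CL (sub σ φ)

record NormalExtension (L : Formula → Set) : Set where
  field
    ⊇CL    : ∀ {φ} → CL φ → L φ
    closeMP  : ∀ {φ ψ} → L (φ ⇒ ψ) → L φ → L ψ
    closeNec : ∀ {φ} → L φ → L (□ φ)
    closeUS  : ∀ {φ} (σ : Subst) → L φ → L (sub σ φ)

Consistent : (Formula → Set) → Set
Consistent L = ¬ L ⊥'

{-# OPTIONS --safe #-}
-- Under □⊥ every boxed formula and, by J1, every φ ▷ ψ is provable, so CL proves
-- □⊥ → (φ ↔ φᶜ), where the collapse φᶜ replaces each □- and ▷-subformula by ⊤.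
-- It therefore suffices that φᶜ is a tautology. If a valuation v falsified φᶜ,
-- substituting ⊤/⊥ for the variables according to v would give a formula in L whose
-- collapse is false everywhere; then L ⊢ ¬□⊥, hence L ⊢ □¬□⊥, and Löb's axiom yields
-- L ⊢ □⊥ and so L ⊢ ⊥.
module Submission where

open import Defs
open import Data.Bool using (Bool; true; false; not; _∧_; _∨_)
open import Data.Empty using (⊥-elim)
open import Relation.Binary.PropositionalEquality
  using (_≡_; refl; sym; trans; cong; cong₂; module ≡-Reasoning)

infix 2 _⊨_
infix 3 _⇔_

_⇔_ : Formula → Formula → Formula
a ⇔ b = (a ⇒ b) ∧' (b ⇒ a)

_⊨_ : (Formula → Bool) → Formula → Set
v ⊨ φ = eval v φ ≡ true

⇒-intro : ∀ v a b → (v ⊨ a → v ⊨ b) → v ⊨ a ⇒ b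
⇒-intro v a b h with eval v a
... | false = refl
... | true  = h refl

⇒-elim : ∀ v a b → v ⊨ a ⇒ b → v ⊨ a → v ⊨ b
⇒-elim v a b h va with eval v a | va
... | true | refl = h

⇔-intro : ∀ v a b → eval v a ≡ eval v b → v ⊨ a ⇔ b
⇔-intro v a b eq with eval v a | eval v b | eq
... | true  | .true  | refl = refl
... | false | .false | refl = refl

⇔-elim : ∀ v a b → v ⊨ a ⇔ b → eval v a ≡ eval v b
⇔-elim v a b h with eval v a | eval v b | h
... | true  | true  | _ = refl
... | false | false | _ = refl

⇒⇔-elim : ∀ v c a b → v ⊨ c ⇒ (a ⇔ b) → v ⊨ c → eval v a ≡ eval v b
⇒⇔-elim v c a b h vc = ⇔-elim v a b (⇒-elim v c (a ⇔ b) h vc)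

⇒-trans : ∀ v a b c → v ⊨ a ⇒ b → v ⊨ b ⇒ c → v ⊨ a ⇒ c
⇒-trans v a b c h₁ h₂ = ⇒-intro v a c λ va → ⇒-elim v b c h₂ (⇒-elim v a b h₁ va)

record PropositionallyClosed (L : Formula → Set) : Set where
  field
    tautology    : ∀ {φ} → Tautology φ → L φ
    modus-ponens : ∀ {φ ψ} → L (φ ⇒ ψ) → L φ → L ψ

  consequence : ∀ {a b} → (∀ v → v ⊨ a → v ⊨ b) → L a → L b
  consequence {a} {b} h = modus-ponens (tautology λ v → ⇒-intro v a b (h v))

  consequence₂ : ∀ {a b c} → (∀ v → v ⊨ a → v ⊨ b → v ⊨ c) → L a → L b → L c
  consequence₂ {a} {b} {c} h La = modus-ponens (modus-ponens
    (tautology λ v → ⇒-intro v a (b ⇒ c) λ va → ⇒-intro v b c (h v va)) La)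

CL-propositionallyClosed : PropositionallyClosed CL
CL-propositionallyClosed = record { tautology = taut ; modus-ponens = mp }

NormalExtension⇒propositionallyClosed : ∀ {L} → NormalExtension L → PropositionallyClosed L
NormalExtension⇒propositionallyClosed NE = record
  { tautology = λ t → ⊇CL (taut t) ; modus-ponens = closeMP }
  where open NormalExtension NE

open PropositionallyClosed CL-propositionallyClosed

p↦_q↦_ : Formula → Formula → Subst
(p↦ a q↦ b) 0 = a
(p↦ a q↦ b) _ = b

□⊥⇒□ : ∀ ψ → CL (□ ⊥' ⇒ □ ψ)
□⊥⇒□ ψ = mp (us (p↦ ⊥' q↦ ψ) axK) (nec (taut λ v → refl))

□⊥⇒▷ : ∀ φ ψ → CL (□ ⊥' ⇒ φ ▷ ψ)
□⊥⇒▷ φ ψ = consequence₂ (λ v → ⇒-trans v (□ ⊥') (□ (φ ⇒ ψ)) (φ ▷ ψ))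
  (□⊥⇒□ (φ ⇒ ψ)) (us (p↦ φ q↦ ψ) axJ1)

infix 3 _⇔[□⊥]_

_⇔[□⊥]_ : Formula → Formula → Set
a ⇔[□⊥] b = CL (□ ⊥' ⇒ (a ⇔ b))

⇔[□⊥]-refl : ∀ a → a ⇔[□⊥] a
⇔[□⊥]-refl a = taut λ v → ⇒-intro v (□ ⊥') (a ⇔ a) λ _ → ⇔-intro v a a refl

⇔[□⊥]-⊤ : ∀ {a} → CL (□ ⊥' ⇒ a) → a ⇔[□⊥] ⊤'
⇔[□⊥]-⊤ {a} = consequence λ v h →
  ⇒-intro v (□ ⊥') (a ⇔ ⊤') λ β → ⇔-intro v a ⊤' (⇒-elim v (□ ⊥') a h β)

¬-cong-⇔[□⊥] : ∀ {a a′} → a ⇔[□⊥] a′ → ¬' a ⇔[□⊥] ¬' a′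
¬-cong-⇔[□⊥] {a} {a′} = consequence λ v h →
  ⇒-intro v (□ ⊥') (¬' a ⇔ ¬' a′) λ β →
    ⇔-intro v (¬' a) (¬' a′) (cong not (⇒⇔-elim v (□ ⊥') a a′ h β))

cong₂-⇔[□⊥] : (_∙_ : Formula → Formula → Formula) (_∘_ : Bool → Bool → Bool) →
  (∀ v a b → eval v (a ∙ b) ≡ eval v a ∘ eval v b) →
  ∀ {a a′ b b′} → a ⇔[□⊥] a′ → b ⇔[□⊥] b′ → a ∙ b ⇔[□⊥] a′ ∙ b′
cong₂-⇔[□⊥] _∙_ _∘_ eval-∙ {a} {a′} {b} {b′} = consequence₂ λ v h₁ h₂ →
  ⇒-intro v (□ ⊥') (a ∙ b ⇔ a′ ∙ b′) λ β →
    ⇔-intro v (a ∙ b) (a′ ∙ b′) (begin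
      eval v (a ∙ b)              ≡⟨ eval-∙ v a b ⟩
      eval v a ∘ eval v b         ≡⟨ cong₂ _∘_ (⇒⇔-elim v (□ ⊥') a a′ h₁ β) (⇒⇔-elim v (□ ⊥') b b′ h₂ β) ⟩
      eval v a′ ∘ eval v b′       ≡⟨ eval-∙ v a′ b′ ⟨
      eval v (a′ ∙ b′)            ∎)
  where open ≡-Reasoning

collapse : Formula → Formula
collapse (var n)  = var n
collapse ⊤'       = ⊤'
collapse ⊥'       = ⊥'
collapse (¬' φ)   = ¬' collapse φ
collapse (φ ∧' ψ) = collapse φ ∧' collapse ψ
collapse (φ ∨' ψ) = collapse φ ∨' collapse ψ
collapse (φ ⇒ ψ)  = collapse φ ⇒ collapse ψ
collapse (□ φ)    = ⊤'
collapse (φ ▷ ψ)  = ⊤'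

collapse-sound : ∀ φ → φ ⇔[□⊥] collapse φ
collapse-sound (var n)  = ⇔[□⊥]-refl (var n)
collapse-sound ⊤'       = ⇔[□⊥]-refl ⊤'
collapse-sound ⊥'       = ⇔[□⊥]-refl ⊥'
collapse-sound (¬' φ)   = ¬-cong-⇔[□⊥] (collapse-sound φ)
collapse-sound (φ ∧' ψ) = cong₂-⇔[□⊥] _∧'_ _∧_ (λ _ _ _ → refl) (collapse-sound φ) (collapse-sound ψ)
collapse-sound (φ ∨' ψ) = cong₂-⇔[□⊥] _∨'_ _∨_ (λ _ _ _ → refl) (collapse-sound φ) (collapse-sound ψ)
collapse-sound (φ ⇒ ψ)  = cong₂-⇔[□⊥] _⇒_ _⇒ᵇ_ (λ _ _ _ → refl) (collapse-sound φ) (collapse-sound ψ)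
collapse-sound (□ φ)    = ⇔[□⊥]-⊤ (□⊥⇒□ φ)
collapse-sound (φ ▷ ψ)  = ⇔[□⊥]-⊤ (□⊥⇒▷ φ ψ)

fromBool : Bool → Formula
fromBool true  = ⊤'
fromBool false = ⊥'

ground : (Formula → Bool) → Subst
ground v n = fromBool (v (var n))

eval-collapse-fromBool : ∀ w b → eval w (collapse (fromBool b)) ≡ b
eval-collapse-fromBool w true  = refl
eval-collapse-fromBool w false = refl

eval-collapse-ground : ∀ v w φ → eval w (collapse (sub (ground v) φ)) ≡ eval v (collapse φ)
eval-collapse-ground v w (var n)  = eval-collapse-fromBool w (v (var n))
eval-collapse-ground v w ⊤'       = refl
eval-collapse-ground v w ⊥'       = refl
eval-collapse-ground v w (¬' φ)   = cong not (eval-collapse-ground v w φ)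
eval-collapse-ground v w (φ ∧' ψ) = cong₂ _∧_ (eval-collapse-ground v w φ) (eval-collapse-ground v w ψ)
eval-collapse-ground v w (φ ∨' ψ) = cong₂ _∨_ (eval-collapse-ground v w φ) (eval-collapse-ground v w ψ)
eval-collapse-ground v w (φ ⇒ ψ)  = cong₂ _⇒ᵇ_ (eval-collapse-ground v w φ) (eval-collapse-ground v w ψ)
eval-collapse-ground v w (□ φ)    = refl
eval-collapse-ground v w (φ ▷ ψ)  = refl

module _ {L : Formula → Set} (NE : NormalExtension L) where
  open NormalExtension NE
  private module L = PropositionallyClosed (NormalExtension⇒propositionallyClosed NE)

  ¬□⊥⇒inconsistent : L (□ ⊥' ⇒ ⊥') → L ⊥'
  ¬□⊥⇒inconsistent ¬□⊥ = closeMP ¬□⊥ (closeMP (⊇CL (us (λ _ → ⊥') axL)) (closeNec ¬□⊥))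

  refutable-collapse⇒¬□⊥ : ∀ {φ} → L φ → (∀ w → eval w (collapse φ) ≡ false) → L (□ ⊥' ⇒ ⊥')
  refutable-collapse⇒¬□⊥ {φ} Lφ refuted = L.consequence₂ refute (⊇CL (collapse-sound φ)) Lφ
    where
    refute : ∀ w → w ⊨ □ ⊥' ⇒ (φ ⇔ collapse φ) → w ⊨ φ → w ⊨ □ ⊥' ⇒ ⊥'
    refute w h wφ = ⇒-intro w (□ ⊥') ⊥' λ β →
      trans (sym (refuted w)) (trans (sym (⇒⇔-elim w (□ ⊥') φ (collapse φ) h β)) wφ)

  collapse-tautology : Consistent L → ∀ {φ} → L φ → Tautology (collapse φ)
  collapse-tautology consistent {φ} Lφ v with eval v (collapse φ) in eq
  ... | true  = refl
  ... | false = ⊥-elim (consistent (¬□⊥⇒inconsistent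
        (refutable-collapse⇒¬□⊥ (closeUS (ground v) Lφ) λ w → trans (eval-collapse-ground v w φ) eq)))

lemma4p11 : (L : Formula → Set) → NormalExtension L → Consistent L →
    (φ : Formula) → L φ → CL (□ ⊥' ⇒ φ)
lemma4p11 L NE consistent φ Lφ =
  consequence₂ transfer (collapse-sound φ) (taut {collapse φ} (collapse-tautology NE consistent Lφ))
  where
  transfer : ∀ v → v ⊨ □ ⊥' ⇒ (φ ⇔ collapse φ) → v ⊨ collapse φ → v ⊨ □ ⊥' ⇒ φ
  transfer v h vᶜ = ⇒-intro v (□ ⊥') φ λ β →
    trans (⇒⇔-elim v (□ ⊥') φ (collapse φ) h β) vᶜ
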